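{- Let $n \ge 2$ and let $f : \{0,1\}^n \to \mathbf{R} \cup \{+\infty\}$ be given by $$f(x_1,\dots,x_n) = \sum_{i \in [n]} h_i x_i + \sum_{1 \le i < j \le n} h_{ij} x_i x_j \qquad (x \in \{0,1\}^n),$$ where $h_i \in \mathbf{R}$ for all $i$, $h_{ij} = h_{ji} \in \mathbf{R} \cup \{+\infty\}$ for all distinct $i,j$. Then $f$ is M${}^\natural$-convex if and only if (i) $h_{ij} \ge \min\{h_{ik}, h_{jk}\}$ for all distinct $i,j,k \in [n]$, and (ii) $h_{ij} \ge 0$ for all distinct $i,j \in [n]$.
   Context: Conventions: $a < +\infty$ and $a + (+\infty) = +\infty$ for $a \in \mathbf{R}$, and $0 \cdot (+\infty) = 0$. $[n]=\{1,\dots,n\}$. For $x \in \mathbf{R}^n$, $\mathrm{supp}^+(x) = \{i \in [n] : x_i > 0\}$; $\chi_i$ is the $i$-th unit vector and $\chi_0$ is the zero vector. A function $f : \{0,1\}^n \to \mathbf{R}\cup\{+\infty\}$ is M${}^\natural$-convex if for all $x,y \in \{0,1\}^n$ and all $i \in \mathrm{supp}^+(x-y)$ there exists $j \in \mathrm{supp}^+(y-x) \cup \{0\}$ with $f(x)+f(y) \ge f(x-\chi_i+\chi_j) + f(y+\chi_i-\chi_j)$. -}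

module Defs where

open import Data.Nat using (ℕ; zero; suc)
open import Data.Fin using (Fin; zero; suc; toℕ; _≟_)
open import Data.Nat using () renaming (_<?_ to _<ℕ?_)
open import Data.Bool using (Bool; true; false; if_then_else_; _∧_)
open import Data.Maybe using (Maybe; just; nothing)
open import Data.Product using (Σ; ∃; _×_; _,_)
open import Data.Unit using (⊤)
open import Data.Sum using (_⊎_)
open import Relation.Nullary using (¬_; yes; no; Dec)
open import Relation.Nullary.Decidable using (⌊_⌋)
open import Relation.Binary.PropositionalEquality using (_≡_; _≢_)

-- The real numbers, given axiomatically as a (Dedekind-)complete ordered
-- field.  Any model is isomorphic to ℝ, so quantifying over all models is
-- faithful to a statement about ℝ.  The order is assumed decidable
-- (true classically for ℝ).
record Reals : Set₁ where
  infixl 6 _+_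
  infixl 7 _*_
  infix 4 _≤_
  field
    Carrier : Set
    _+_ _*_ : Carrier → Carrier → Carrier
    -_      : Carrier → Carrier
    0# 1#   : Carrier
    _≤_     : Carrier → Carrier → Set
    +-assoc     : ∀ x y z → (x + y) + z ≡ x + (y + z)
    +-comm      : ∀ x y → x + y ≡ y + x
    +-identityˡ : ∀ x → 0# + x ≡ x
    +-inverseˡ  : ∀ x → (- x) + x ≡ 0#
    *-assoc     : ∀ x y z → (x * y) * z ≡ x * (y * z)
    *-comm      : ∀ x y → x * y ≡ y * x
    *-identityˡ : ∀ x → 1# * x ≡ x
    distribˡ    : ∀ x y z → x * (y + z) ≡ (x * y) + (x * z)
    0≢1         : 0# ≢ 1#
    *-inverse   : ∀ x → x ≢ 0# → ∃ λ y → y * x ≡ 1#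
    ≤-refl    : ∀ x → x ≤ x
    ≤-trans   : ∀ {x y z} → x ≤ y → y ≤ z → x ≤ z
    ≤-antisym : ∀ {x y} → x ≤ y → y ≤ x → x ≡ y
    _≤?_      : ∀ x y → Dec (x ≤ y)
    ≤-total   : ∀ x y → x ≤ y ⊎ y ≤ x
    +-mono-≤  : ∀ {x y} z → x ≤ y → x + z ≤ y + z
    *-nonneg  : ∀ {x y} → 0# ≤ x → 0# ≤ y → 0# ≤ x * y
    sup : (P : Carrier → Set) → ∃ P → (∃ λ b → ∀ x → P x → x ≤ b) →
          ∃ λ s → (∀ x → P x → x ≤ s) × (∀ b → (∀ x → P x → x ≤ b) → s ≤ b)

module Ext (R : Reals) where
  open Reals R

  data ℝ∞ : Set where
    fin : Carrier → ℝ∞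
    ∞   : ℝ∞

  infixl 6 _+∞_
  _+∞_ : ℝ∞ → ℝ∞ → ℝ∞
  fin a +∞ fin b = fin (a + b)
  fin a +∞ ∞     = ∞
  ∞     +∞ _     = ∞

  infix 4 _≤∞_
  data _≤∞_ : ℝ∞ → ℝ∞ → Set where
    fin≤fin : ∀ {a b} → a ≤ b → fin a ≤∞ fin b
    _≤∞top  : ∀ x → x ≤∞ ∞

  min∞ : ℝ∞ → ℝ∞ → ℝ∞
  min∞ ∞ b = b
  min∞ (fin a) ∞ = fin a
  min∞ (fin a) (fin b) with a ≤? b
  ... | yes _ = fin a
  ... | no  _ = fin b

  Cube : ℕ → Set
  Cube n = Fin n → Bool

  sumℝ∞ : ∀ {n} → (Fin n → ℝ∞) → ℝ∞
  sumℝ∞ {zero}  g = fin 0#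
  sumℝ∞ {suc n} g = g zero +∞ sumℝ∞ (λ k → g (suc k))

  -- c · x_i with x_i ∈ {0,1}, using 0 · (+∞) = 0
  scale : Bool → ℝ∞ → ℝ∞
  scale b v = if b then v else fin 0#

  quadFun : ∀ {n} → (Fin n → Carrier) → (Fin n → Fin n → ℝ∞) → Cube n → ℝ∞
  quadFun h H x =
    sumℝ∞ (λ i → scale (x i) (fin (h i)))
    +∞ sumℝ∞ (λ i → sumℝ∞ (λ j →
         scale (⌊ toℕ i <ℕ? toℕ j ⌋ ∧ x i ∧ x j) (H i j)))

  -- x - χ_i + χ_j   (j = nothing means χ_0 = 0)
  moveOut : ∀ {n} → Cube n → Fin n → Maybe (Fin n) → Cube n
  moveOut x i j k with k ≟ i
  ... | yes _ = false
  ... | no _ with j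
  ...   | nothing = x k
  ...   | just j' = if ⌊ k ≟ j' ⌋ then true else x k

  moveIn : ∀ {n} → Cube n → Fin n → Maybe (Fin n) → Cube n
  moveIn y i j k with k ≟ i
  ... | yes _ = true
  ... | no _ with j
  ...   | nothing = y k
  ...   | just j' = if ⌊ k ≟ j' ⌋ then false else y k

  -- j ∈ supp⁺(y - x) ∪ {0}
  InSuppPlus∪0 : ∀ {n} → Cube n → Cube n → Maybe (Fin n) → Set
  InSuppPlus∪0 y x nothing  = ⊤
  InSuppPlus∪0 y x (just j) = (y j ≡ true) × (x j ≡ false)

  MNatConvex : ∀ {n} → (Cube n → ℝ∞) → Set
  MNatConvex {n} f =
    ∀ (x y : Cube n) (i : Fin n) → x i ≡ true → y i ≡ false →
    ∃ λ (j : Maybe (Fin n)) → InSuppPlus∪0 y x j ×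
      (f (moveOut x i j) +∞ f (moveIn y i j) ≤∞ f x +∞ f y)

module Submission where

-- Necessity: exchanging i between {i,j} and ∅ gives (ii); between {i,j}
-- and {k} it gives h_ik ≤ h_ij or h_jk ≤ h_ij, hence (i).
--
-- Sufficiency: adding a point k to a set x raises f by h_k + δ(x,k), where
-- δ(x,k) = Σ_{a∈x} h_ka is the interaction of k with x.  Each exchange thus
-- reduces to an inequality between sums of interactions, which follows from
-- a dominance lemma: Σ g ≤ Σ g′ when every level t is exceeded by at most as
-- many terms of g as of g′.  By (i), h is an ultrametric similarity, and the
-- terms of δ(x,c) above a level t > 0 are the points of x in the cluster of c
-- at level t.  Weighting y ∖ x₀ by +1 and x₀ ∖ y by -1 (x₀ = x - χ_i), the
-- exchange lemma for clusters shows that either every cluster of i is light,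
-- and i moves alone, or some j ∈ y ∖ x has clusters outweighing those of i,
-- and i is exchanged with j.  The exchange lemma is proved by a covering
-- argument with maximal light clusters.

open import Defs
open import Algebra.Bundles using (CommutativeMonoid)
import Algebra.Solver.CommutativeMonoid as CMSolver
open import Data.Bool using (Bool; true; false; if_then_else_; _∧_; _∨_; not)
import Data.Bool.Properties as Bool
open import Data.Empty using (⊥; ⊥-elim)
open import Data.Fin using (Fin; zero; suc; _≟_; toℕ; splitAt)
open import Data.Fin.Properties using (any?; suc-injective; toℕ-injective)
open import Data.Integer as ℤ using (ℤ; +_; 0ℤ; 1ℤ)
import Data.Integer.Properties as ℤ
open import Data.Integer.Solver using (module +-*-Solver)
open import Data.Maybe using (Maybe; just; nothing)
open import Data.Nat as ℕ using (ℕ; zero; suc)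
open import Data.Nat using () renaming (_<?_ to _<ℕ?_)
import Data.Nat.Properties as ℕ
open import Data.Product using (Σ; ∃; _×_; _,_; proj₁; proj₂)
open import Data.Sum using (_⊎_; inj₁; inj₂)
open import Data.Unit using (⊤; tt)
open import Data.Vec.Functional using (removeAt; _++_)
open import Function using (_∘_)
open import Function.Bundles using (_⇔_; mk⇔)
open import Relation.Binary.Bundles using (Preorder)
open import Relation.Binary.Core using (Rel)
open import Relation.Binary.Definitions using (tri<; tri≈; tri>)
open import Relation.Binary.PropositionalEquality
import Relation.Binary.Reasoning.Preorder as PreorderReasoning
open import Relation.Nullary using (¬_; ¬?; yes; no; Dec)
open import Relation.Nullary.Decidable using (⌊_⌋; _×-dec_)
open import Relation.Unary using (Decidable)

𝟙 : Bool → ℕ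
𝟙 b = if b then 1 else 0

∧-intro : ∀ {x y} → x ≡ true → y ≡ true → x ∧ y ≡ true
∧-intro refl refl = refl

∧-elim : ∀ x {y} → x ∧ y ≡ true → x ≡ true × y ≡ true
∧-elim true p = refl , p

true≢false : true ≢ false
true≢false ()

⌊⌋-true : ∀ {P : Set} (d : Dec P) → P → ⌊ d ⌋ ≡ true
⌊⌋-true (yes _) _ = refl
⌊⌋-true (no ¬p) p = ⊥-elim (¬p p)

⌊⌋-false : ∀ {P : Set} (d : Dec P) → ¬ P → ⌊ d ⌋ ≡ false
⌊⌋-false (yes p) ¬p = ⊥-elim (¬p p)
⌊⌋-false (no _)  _  = refl

⌊⌋-sound : ∀ {P : Set} (d : Dec P) → ⌊ d ⌋ ≡ true → P
⌊⌋-sound (yes p) _ = p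

⌊⌋-cong : ∀ {P Q : Set} (d : Dec P) (e : Dec Q) → (P → Q) → (Q → P) → ⌊ d ⌋ ≡ ⌊ e ⌋
⌊⌋-cong (yes p) e P→Q _   = sym (⌊⌋-true e (P→Q p))
⌊⌋-cong (no ¬p) e _   Q→P = sym (⌊⌋-false e (¬p ∘ Q→P))

infixl 7 _∩_ _∖_
_∩_ _∖_ : ∀ {n} → (Fin n → Bool) → (Fin n → Bool) → Fin n → Bool
(U ∩ V) a = U a ∧ V a
(U ∖ V) a = U a ∧ not (V a)

∘-++ : ∀ {A B : Set} {m n} (f : A → B) (xs : Fin m → A) (ys : Fin n → A) →
       f ∘ (xs ++ ys) ≗ (f ∘ xs) ++ (f ∘ ys)
∘-++ {m = m} f xs ys i with splitAt m i
... | inj₁ k = refl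
... | inj₂ k = refl

++-all : ∀ {A : Set} {P : A → Set} {m n} (xs : Fin m → A) (ys : Fin n → A) →
         (∀ k → P (xs k)) → (∀ k → P (ys k)) → ∀ k → P ((xs ++ ys) k)
++-all {m = m} xs ys Pxs Pys k with splitAt m k
... | inj₁ k′ = Pxs k′
... | inj₂ k′ = Pys k′

module FiniteSums {c ℓ} (M : CommutativeMonoid c ℓ) where
  open CommutativeMonoid M renaming ( _∙_ to _+_; ε to 0#; ∙-cong to +-cong; ∙-congˡ to +-congˡ
                                    ; refl to ≈-refl; sym to ≈-sym; trans to ≈-trans; reflexive to ≈-reflexive)
  open import Algebra.Properties.CommutativeMonoid.Sum M public
    using (sum; sum-cong-≋; sum-cong-≗; sum-remove; ∑-distrib-+)

  sum-zero : ∀ {n} (g : Fin n → Carrier) → (∀ k → g k ≈ 0#) → sum g ≈ 0#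
  sum-zero {zero}  g z = ≈-refl
  sum-zero {suc n} g z = ≈-trans (+-cong (z zero) (sum-zero (g ∘ suc) (z ∘ suc))) (identityˡ 0#)

  sum-point : ∀ {n} (g : Fin n → Carrier) (a : Fin n) →
              (∀ k → k ≢ a → g k ≈ 0#) → sum g ≈ g a
  sum-point g zero z =
    ≈-trans (+-congˡ (sum-zero (g ∘ suc) (λ k → z (suc k) λ ()))) (identityʳ _)
  sum-point g (suc a) z =
    ≈-trans (+-cong (z zero λ ()) (sum-point (g ∘ suc) a (λ k k≢a → z (suc k) (k≢a ∘ suc-injective))))
          (identityˡ _)

  sum-update : ∀ {n} (g g′ : Fin n → Carrier) (a : Fin n) (v : Carrier) →
               (∀ k → k ≢ a → g′ k ≈ g k) → g′ a ≈ g a + v → sum g′ ≈ sum g + v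
  sum-update g g′ a v same at-a =
    ≈-trans (sum-cong-≋ split) (≈-trans (∑-distrib-+ g bump) (+-congˡ (≈-trans (sum-point bump a off-a) bump-a)))
    where
    bump : Fin _ → Carrier
    bump k = if ⌊ k ≟ a ⌋ then v else 0#
    split : ∀ k → g′ k ≈ g k + bump k
    split k with k ≟ a
    ... | yes refl = at-a
    ... | no k≢a   = ≈-trans (same k k≢a) (≈-sym (identityʳ (g k)))
    off-a : ∀ k → k ≢ a → bump k ≈ 0#
    off-a k k≢a with k ≟ a
    ... | yes k≡a = ⊥-elim (k≢a k≡a)
    ... | no _    = ≈-refl
    bump-a : bump a ≈ v
    bump-a with a ≟ a
    ... | yes _   = ≈-refl
    ... | no a≢a  = ⊥-elim (a≢a refl)

  sum-++ : ∀ {m n} (xs : Fin m → Carrier) (ys : Fin n → Carrier) →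
           sum (xs ++ ys) ≈ sum xs + sum ys
  sum-++ {zero}  xs ys = ≈-sym (identityˡ _)
  sum-++ {suc m} xs ys =
    ≈-trans (+-congˡ (≈-trans (≈-reflexive (sum-cong-≗ tail-++)) (sum-++ (xs ∘ suc) ys)))
          (≈-sym (assoc _ _ _))
    where
    tail-++ : (xs ++ ys) ∘ suc ≗ (xs ∘ suc) ++ ys
    tail-++ i with splitAt m i
    ... | inj₁ k = refl
    ... | inj₂ k = refl

  sumOver : ∀ {n} → (Fin n → Bool) → (Fin n → Carrier) → Carrier
  sumOver U g = sum (λ a → if U a then g a else 0#)

  sumOver-cong : ∀ {n} {U V : Fin n → Bool} (g : Fin n → Carrier) → U ≗ V → sumOver U g ≡ sumOver V g
  sumOver-cong g U≗V = sum-cong-≗ (λ a → cong (λ b → if b then g a else 0#) (U≗V a))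

  sumOver-split : ∀ {n} (U V : Fin n → Bool) (g : Fin n → Carrier) →
                  sumOver U g ≈ sumOver (U ∩ V) g + sumOver (U ∖ V) g
  sumOver-split U V g =
    ≈-trans (sum-cong-≋ pointwise)
          (∑-distrib-+ (λ a → if U a ∧ V a then g a else 0#) (λ a → if U a ∧ not (V a) then g a else 0#))
    where
    pointwise : ∀ a → (if U a then g a else 0#) ≈
                      (if U a ∧ V a then g a else 0#) + (if U a ∧ not (V a) then g a else 0#)
    pointwise a with U a | V a
    ... | true  | true  = ≈-sym (identityʳ (g a))
    ... | true  | false = ≈-sym (identityˡ (g a))
    ... | false | _     = ≈-sym (identityˡ 0#)

  module Monotone {r} (_≼_ : Rel Carrier r) (≼-refl : ∀ x → x ≼ x)
                  (+-mono : ∀ {x y u v} → x ≼ y → u ≼ v → (x + u) ≼ (y + v)) where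
    sum-mono : ∀ {n} {g g′ : Fin n → Carrier} → (∀ k → g k ≼ g′ k) → sum g ≼ sum g′
    sum-mono {zero}  le = ≼-refl 0#
    sum-mono {suc n} le = +-mono (le zero) (sum-mono (le ∘ suc))

module Extremum {A : Set} {r} (_≼_ : Rel A r) (≼-refl : ∀ x → x ≼ x)
                (≼-trans : ∀ {x y z} → x ≼ y → y ≼ z → x ≼ z)
                (≼-total : ∀ x y → x ≼ y ⊎ y ≼ x) where

  best : ∀ {n} {P : Fin n → Set} → Decidable P → (key : Fin n → A) → ∃ P →
         Σ (Fin n) λ a → P a × (∀ b → P b → key a ≼ key b)
  best {suc n} {P} P? key (a , pa) with any? (P? ∘ suc)
  ... | yes rest with best (P? ∘ suc) (key ∘ suc) rest
  ...   | b , pb , b-best with P? zero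
  ...     | no ¬p0 = suc b , pb , λ { zero p0 → ⊥-elim (¬p0 p0) ; (suc c) pc → b-best c pc }
  ...     | yes p0 with ≼-total (key zero) (key (suc b))
  ...       | inj₁ 0≼b = zero , p0 , λ { zero _ → ≼-refl (key zero) ; (suc c) pc → ≼-trans 0≼b (b-best c pc) }
  ...       | inj₂ b≼0 = suc b , pb , λ { zero _ → b≼0 ; (suc c) pc → b-best c pc }
  best {suc n} {P} P? key (zero , p0) | no none =
    zero , p0 , λ { zero _ → ≼-refl (key zero) ; (suc c) pc → ⊥-elim (none (c , pc)) }
  best {suc n} {P} P? key (suc a , pa) | no none = ⊥-elim (none (a , pa))

module ℕΣ = FiniteSums ℕ.+-0-commutativeMonoid
module ℤΣ = FiniteSums ℤ.+-0-commutativeMonoid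

size : ∀ {n} → (Fin n → Bool) → ℕ
size U = ℕΣ.sumOver U (λ _ → 1)

size-pos : ∀ {n} (U : Fin n → Bool) (q : Fin n) → U q ≡ true → 1 ℕ.≤ size U
size-pos U zero    Uq rewrite Uq = ℕ.s≤s ℕ.z≤n
size-pos U (suc q) Uq = ℕ.≤-trans (size-pos (U ∘ suc) q Uq) (ℕ.m≤n+m _ _)

size-witness : ∀ {n} (U : Fin n → Bool) → 1 ℕ.≤ size U → ∃ λ q → U q ≡ true
size-witness {zero}  U ()
size-witness {suc n} U 1≤size with U zero in U0
... | true  = zero , U0
... | false = let q , Uq = size-witness (U ∘ suc) 1≤size in suc q , Uq

≤1∧≢1⇒≤0 : ∀ {x} → x ℤ.≤ 1ℤ → x ≢ 1ℤ → x ℤ.≤ 0ℤ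
≤1∧≢1⇒≤0 {+ zero}          _ _   = ℤ.≤-refl
≤1∧≢1⇒≤0 {+ suc zero}      _ x≢1 = ⊥-elim (x≢1 refl)
≤1∧≢1⇒≤0 {+ suc (suc _)}   (ℤ.+≤+ (ℕ.s≤s ())) _
≤1∧≢1⇒≤0 {ℤ.-[1+ _ ]}      _ _   = ℤ.-≤+

1≰0 : ∀ {x} → 1ℤ ℤ.≤ x → x ℤ.≤ 0ℤ → ⊥
1≰0 1≤x x≤0 with ℤ.≤-trans 1≤x x≤0
... | ℤ.+≤+ ()

≰0⇒≥1 : ∀ {x} → ¬ (x ℤ.≤ 0ℤ) → 1ℤ ℤ.≤ x
≰0⇒≥1 x≰0 = ℤ.i<j⇒suc[i]≤j (ℤ.≰⇒> x≰0)

≱1⇒≤0 : ∀ {x} → ¬ (1ℤ ℤ.≤ x) → x ℤ.≤ 0ℤ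
≱1⇒≤0 1≰x = ℤ.i<j⇒i≤pred[j] (ℤ.≰⇒> 1≰x)

𝟙-difference≤1 : ∀ b c → + 𝟙 b ℤ.- + 𝟙 c ℤ.≤ 1ℤ
𝟙-difference≤1 true  true  = ℤ.+≤+ ℕ.z≤n
𝟙-difference≤1 true  false = ℤ.≤-refl
𝟙-difference≤1 false true  = ℤ.-≤+
𝟙-difference≤1 false false = ℤ.+≤+ ℕ.z≤n

𝟙-difference≡1 : ∀ b c → + 𝟙 b ℤ.- + 𝟙 c ≡ 1ℤ → b ≡ true × c ≡ false
𝟙-difference≡1 true  false _  = refl , refl
𝟙-difference≡1 true  true  ()
𝟙-difference≡1 false true  ()
𝟙-difference≡1 false false ()

difference≤0 : ∀ a b → + a ℤ.- + b ℤ.≤ 0ℤ → a ℕ.≤ b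
difference≤0 a b a-b≤0 = ℤ.drop‿+≤+ (ℤ.i-j≤0⇒i≤j a-b≤0)

-- The count inequality behind an exchange with a partner.
exchange-arithmetic : ∀ a b c d e →
  (+ (a ℕ.+ e) ℤ.- + c) ℤ.+ 1ℤ ℤ.≤ (+ (d ℕ.+ 1) ℤ.- + b) ℤ.+ + e → b ℕ.+ a ℕ.≤ c ℕ.+ d
exchange-arithmetic a b c d e le = difference≤0 (b ℕ.+ a) (c ℕ.+ d) (subst (ℤ._≤ 0ℤ) identity (ℤ.i≤j⇒i-j≤0 le))
  where
  open +-*-Solver using (solve; _:+_; _:-_; _:=_; con)
  identity : ((+ (a ℕ.+ e) ℤ.- + c) ℤ.+ 1ℤ) ℤ.- ((+ (d ℕ.+ 1) ℤ.- + b) ℤ.+ + e) ≡ + (b ℕ.+ a) ℤ.- + (c ℕ.+ d)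
  identity rewrite ℤ.pos-+ a e | ℤ.pos-+ d 1 | ℤ.pos-+ b a | ℤ.pos-+ c d =
    solve 5 (λ A B C D E → (((A :+ E) :- C) :+ con 1ℤ) :- (((D :+ con 1ℤ) :- B) :+ E) := (B :+ A) :- (C :+ D))
            refl (+ a) (+ b) (+ c) (+ d) (+ e)

-- Integer weights w ≤ 1 on [n]; an element is positive when its weight is 1.
module Weights {n} (w : Fin n → ℤ) (w≤1 : ∀ a → w a ℤ.≤ 1ℤ) where

  weight : (Fin n → Bool) → ℤ
  weight U = ℤΣ.sumOver U w

  weight-nonpos : ∀ U → (∀ a → U a ≡ true → w a ≢ 1ℤ) → weight U ℤ.≤ 0ℤ
  weight-nonpos U no-pos = ℤ.≤-trans (ℤΣ.Monotone.sum-mono ℤ._≤_ (λ _ → ℤ.≤-refl) ℤ.+-mono-≤ term≤0)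
                                     (ℤ.≤-reflexive (ℤΣ.sum-zero {n} (λ _ → 0ℤ) (λ _ → refl)))
    where
    term≤0 : ∀ a → (if U a then w a else 0ℤ) ℤ.≤ 0ℤ
    term≤0 a with U a in Ua
    ... | true  = ≤1∧≢1⇒≤0 (w≤1 a) (no-pos a Ua)
    ... | false = ℤ.≤-refl

  weight-mono : ∀ U V → (∀ a → V a ≡ true → U a ≡ true) →
                (∀ a → U a ≡ true → V a ≡ false → w a ≢ 1ℤ) → weight U ℤ.≤ weight V
  weight-mono U V V⊆U keep = begin
    weight U                          ≡⟨ ℤΣ.sumOver-split U V w ⟩
    weight (U ∩ V) ℤ.+ weight (U ∖ V) ≤⟨ ℤ.+-mono-≤ (ℤ.≤-reflexive (ℤΣ.sumOver-cong w U∩V≗V))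
                                                   (weight-nonpos (U ∖ V) dropped) ⟩
    weight V ℤ.+ 0ℤ                   ≡⟨ ℤ.+-identityʳ _ ⟩
    weight V                          ∎
    where
    open ℤ.≤-Reasoning
    U∩V≗V : U ∩ V ≗ V
    U∩V≗V a with V a in Va
    ... | true  = ∧-intro (V⊆U a Va) refl
    ... | false = Bool.∧-zeroʳ (U a)
    dropped : ∀ a → (U ∖ V) a ≡ true → w a ≢ 1ℤ
    dropped a UVa with U a in Ua | V a in Va
    ... | true | false = keep a Ua Va

  -- Suppose every positive element q of a set R carries a
  -- block K q ∋ q of nonpositive weight, and two blocks that meet contain
  -- each other's centres in the sense that K q ∩ K q′ ≠ ∅ ⇒ q′ ∈ K q.  Then
  -- every U ⊆ R containing the blocks of its positive elements has
  -- nonpositive weight: U is the disjoint union of some blocks and of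
  -- elements that are not positive.
  module Cover (R : Fin n → Bool) (K : Fin n → Fin n → Bool)
    (K-centre : ∀ q → R q ≡ true → w q ≡ 1ℤ → K q q ≡ true)
    (K-light  : ∀ q → R q ≡ true → w q ≡ 1ℤ → weight (K q) ℤ.≤ 0ℤ)
    (K-meet   : ∀ q q′ → R q ≡ true → w q ≡ 1ℤ → R q′ ≡ true → w q′ ≡ 1ℤ →
                ∀ b → K q b ≡ true → K q′ b ≡ true → K q q′ ≡ true) where

    cover : ∀ m (U : Fin n → Bool) → size U ℕ.≤ m → (∀ a → U a ≡ true → R a ≡ true) →
            (∀ q → U q ≡ true → w q ≡ 1ℤ → ∀ a → K q a ≡ true → U a ≡ true) →
            weight U ℤ.≤ 0ℤ
    cover m U size≤m U⊆R closed with any? (λ q → (U q Bool.≟ true) ×-dec (w q ℤ.≟ 1ℤ))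
    ... | no none = weight-nonpos U (λ a Ua wa → none (a , Ua , wa))
    ... | yes (q , Uq , wq) = peel m size≤m
      where
      Rq = U⊆R q Uq
      U′ = U ∖ K q

      block⊆U : U ∩ K q ≗ K q
      block⊆U a with K q a in Kqa
      ... | true  = ∧-intro (closed q Uq wq a Kqa) refl
      ... | false = Bool.∧-zeroʳ (U a)

      size-split : size U ≡ size (U ∩ K q) ℕ.+ size U′
      size-split = ℕΣ.sumOver-split U (K q) (λ _ → 1)

      smaller : 1 ℕ.+ size U′ ℕ.≤ size U
      smaller = subst (1 ℕ.+ size U′ ℕ.≤_) (sym size-split)
                  (ℕ.+-monoˡ-≤ (size U′)
                    (size-pos (U ∩ K q) q (∧-intro Uq (K-centre q Rq wq))))

      weight-split : weight U ≡ weight (K q) ℤ.+ weight U′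
      weight-split = trans (ℤΣ.sumOver-split U (K q) w)
                           (cong (ℤ._+ weight U′) (ℤΣ.sumOver-cong w block⊆U))

      U′-closed : ∀ q′ → U′ q′ ≡ true → w q′ ≡ 1ℤ → ∀ a → K q′ a ≡ true → U′ a ≡ true
      U′-closed q′ U′q′ wq′ a Kq′a with K q q′ in Kqq′ | ∧-elim (U q′) U′q′ | K q a in Kqa
      ... | false | Uq′ , _ | true  =
            ⊥-elim (true≢false (trans (sym (K-meet q q′ Rq wq (U⊆R q′ Uq′) wq′ a Kqa Kq′a)) Kqq′))
      ... | false | Uq′ , _ | false = ∧-intro (closed q′ Uq′ wq′ a Kq′a) refl
      ... | true  | _ , ()  | _

      peel : ∀ m → size U ℕ.≤ m → weight U ℤ.≤ 0ℤ
      peel zero    size≤0 = ⊥-elim (ℕ.<⇒≱ (ℕ.≤-trans smaller size≤0) ℕ.z≤n)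
      peel (suc m) size≤m = subst (ℤ._≤ 0ℤ) (sym weight-split)
        (ℤ.+-mono-≤ (K-light q Rq wq)
          (cover m U′ (ℕ.≤-pred (ℕ.≤-trans smaller size≤m))
                 (λ a U′a → U⊆R a (proj₁ (∧-elim (U a) U′a))) U′-closed))

sum-pos : ∀ {n} (g : Fin n → ℕ) → ℤΣ.sum (λ a → + g a) ≡ + ℕΣ.sum g
sum-pos {zero}  g = refl
sum-pos {suc n} g = trans (cong (λ z → (+ g zero) ℤ.+ z) (sum-pos (g ∘ suc))) (sym (ℤ.pos-+ (g zero) _))

sum-neg : ∀ {n} (g : Fin n → ℤ) → ℤΣ.sum (λ a → ℤ.- g a) ≡ ℤ.- ℤΣ.sum g
sum-neg {zero}  g = refl
sum-neg {suc n} g = trans (cong (λ z → (ℤ.- g zero) ℤ.+ z) (sum-neg (g ∘ suc))) (sym (ℤ.neg-distrib-+ (g zero) _))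

weight-difference : ∀ {n} (y x U : Fin n → Bool) →
  ℤΣ.sumOver U (λ a → + 𝟙 (y a) ℤ.- + 𝟙 (x a)) ≡ + size (y ∩ U) ℤ.- + size (x ∩ U)
weight-difference y x U = begin
  ℤΣ.sumOver U (λ a → + 𝟙 (y a) ℤ.- + 𝟙 (x a))
    ≡⟨ ℤΣ.sum-cong-≗ pointwise ⟩
  ℤΣ.sum (λ a → + 𝟙 (y a ∧ U a) ℤ.+ ℤ.- + 𝟙 (x a ∧ U a))
    ≡⟨ ℤΣ.∑-distrib-+ (λ a → + 𝟙 (y a ∧ U a)) (λ a → ℤ.- + 𝟙 (x a ∧ U a)) ⟩
  ℤΣ.sum (λ a → + 𝟙 (y a ∧ U a)) ℤ.+ ℤΣ.sum (λ a → ℤ.- + 𝟙 (x a ∧ U a))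
    ≡⟨ cong₂ ℤ._+_ (sum-pos (λ a → 𝟙 (y a ∧ U a)))
                   (trans (sum-neg (λ a → + 𝟙 (x a ∧ U a))) (cong ℤ.-_ (sum-pos (λ a → 𝟙 (x a ∧ U a))))) ⟩
  + size (y ∩ U) ℤ.- + size (x ∩ U) ∎
  where
  open ≡-Reasoning
  pointwise : ∀ a → (if U a then + 𝟙 (y a) ℤ.- + 𝟙 (x a) else 0ℤ) ≡
                    + 𝟙 (y a ∧ U a) ℤ.+ ℤ.- + 𝟙 (x a ∧ U a)
  pointwise a with U a | y a | x a
  ... | true  | true  | true  = refl
  ... | true  | true  | false = refl
  ... | true  | false | true  = refl
  ... | true  | false | false = refl
  ... | false | true  | true  = refl
  ... | false | true  | false = refl
  ... | false | false | true  = refl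
  ... | false | false | false = refl

module Theory (R : Reals) where
  open Reals R
  open Ext R

  +-monoʳ-≤ : ∀ {x y} z → x ≤ y → z + x ≤ z + y
  +-monoʳ-≤ {x} {y} z x≤y = subst₂ _≤_ (+-comm x z) (+-comm y z) (+-mono-≤ z x≤y)

  +-cancelˡ-≤ : ∀ {x y} z → z + x ≤ z + y → x ≤ y
  +-cancelˡ-≤ {x} {y} z le = subst₂ _≤_ (cancel x) (cancel y) (+-monoʳ-≤ (- z) le)
    where
    cancel : ∀ u → (- z) + (z + u) ≡ u
    cancel u = trans (sym (+-assoc (- z) z u)) (trans (cong (_+ u) (+-inverseˡ z)) (+-identityˡ u))

  +∞-assoc : ∀ a b c → (a +∞ b) +∞ c ≡ a +∞ (b +∞ c)
  +∞-assoc (fin a) (fin b) (fin c) = cong fin (+-assoc a b c)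
  +∞-assoc (fin a) (fin b) ∞       = refl
  +∞-assoc (fin a) ∞       c       = refl
  +∞-assoc ∞       b       c       = refl

  +∞-comm : ∀ a b → a +∞ b ≡ b +∞ a
  +∞-comm (fin a) (fin b) = cong fin (+-comm a b)
  +∞-comm (fin a) ∞       = refl
  +∞-comm ∞       (fin b) = refl
  +∞-comm ∞       ∞       = refl

  +∞-identityˡ : ∀ a → fin 0# +∞ a ≡ a
  +∞-identityˡ (fin a) = cong fin (+-identityˡ a)
  +∞-identityˡ ∞       = refl

  +∞-identityʳ : ∀ a → a +∞ fin 0# ≡ a
  +∞-identityʳ a = trans (+∞-comm a (fin 0#)) (+∞-identityˡ a)

  ℝ∞-commutativeMonoid : CommutativeMonoid _ _
  ℝ∞-commutativeMonoid = record
    { Carrier = ℝ∞ ; _≈_ = _≡_ ; _∙_ = _+∞_ ; ε = fin 0#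
    ; isCommutativeMonoid = record
      { isMonoid = record
        { isSemigroup = record
          { isMagma = record { isEquivalence = isEquivalence ; ∙-cong = cong₂ _+∞_ }
          ; assoc = +∞-assoc }
        ; identity = +∞-identityˡ , +∞-identityʳ }
      ; comm = +∞-comm } }

  ≤∞-refl : ∀ a → a ≤∞ a
  ≤∞-refl (fin a) = fin≤fin (≤-refl a)
  ≤∞-refl ∞       = ∞ ≤∞top

  ≤∞-trans : ∀ {a b c} → a ≤∞ b → b ≤∞ c → a ≤∞ c
  ≤∞-trans (fin≤fin p) (fin≤fin q) = fin≤fin (≤-trans p q)
  ≤∞-trans p           (_ ≤∞top)   = _ ≤∞top

  ≤∞-total : ∀ a b → a ≤∞ b ⊎ b ≤∞ a
  ≤∞-total (fin a) (fin b) with ≤-total a b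
  ... | inj₁ a≤b = inj₁ (fin≤fin a≤b)
  ... | inj₂ b≤a = inj₂ (fin≤fin b≤a)
  ≤∞-total a ∞ = inj₁ (a ≤∞top)
  ≤∞-total ∞ b = inj₂ (b ≤∞top)

  _≤∞?_ : ∀ a b → Dec (a ≤∞ b)
  fin a ≤∞? fin b with a ≤? b
  ... | yes a≤b = yes (fin≤fin a≤b)
  ... | no  a≰b = no λ { (fin≤fin a≤b) → a≰b a≤b }
  ∞ ≤∞? fin b = no λ ()
  a ≤∞? ∞     = yes (a ≤∞top)

  ≰∞⇒≥ : ∀ {a b} → ¬ (a ≤∞ b) → b ≤∞ a
  ≰∞⇒≥ {a} {b} a≰b with ≤∞-total a b
  ... | inj₁ a≤b = ⊥-elim (a≰b a≤b)
  ... | inj₂ b≤a = b≤a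

  +∞-monoˡ-≤ : ∀ {a b} c → a ≤∞ b → a +∞ c ≤∞ b +∞ c
  +∞-monoˡ-≤ (fin c) (fin≤fin p) = fin≤fin (+-mono-≤ c p)
  +∞-monoˡ-≤ ∞       (fin≤fin p) = ∞ ≤∞top
  +∞-monoˡ-≤ c       (_ ≤∞top)   = _ ≤∞top

  +∞-monoʳ-≤ : ∀ {a b} c → a ≤∞ b → c +∞ a ≤∞ c +∞ b
  +∞-monoʳ-≤ {a} {b} c p = subst₂ _≤∞_ (+∞-comm a c) (+∞-comm b c) (+∞-monoˡ-≤ c p)

  +∞-mono-≤ : ∀ {a b c d} → a ≤∞ b → c ≤∞ d → a +∞ c ≤∞ b +∞ d
  +∞-mono-≤ {b = b} {c} p q = ≤∞-trans (+∞-monoˡ-≤ c p) (+∞-monoʳ-≤ b q)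

  ≤∞-preorder : Preorder _ _ _
  ≤∞-preorder = record
    { Carrier = ℝ∞ ; _≈_ = _≡_ ; _≲_ = _≤∞_
    ; isPreorder = record { isEquivalence = isEquivalence
                          ; reflexive = λ { refl → ≤∞-refl _ } ; trans = ≤∞-trans } }

  module ≤∞-Reasoning = PreorderReasoning ≤∞-preorder

  +∞-cancelˡ-≤ : ∀ z {a b} → fin z +∞ a ≤∞ fin z +∞ b → a ≤∞ b
  +∞-cancelˡ-≤ z {fin a} {fin b} (fin≤fin p) = fin≤fin (+-cancelˡ-≤ z p)
  +∞-cancelˡ-≤ z {a}     {∞}     _           = a ≤∞top

  min∞-≤ˡ : ∀ a b → min∞ a b ≤∞ a
  min∞-≤ˡ ∞ b = b ≤∞top
  min∞-≤ˡ (fin a) ∞ = ≤∞-refl (fin a)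
  min∞-≤ˡ (fin a) (fin b) with a ≤? b
  ... | yes _   = ≤∞-refl (fin a)
  ... | no  a≰b = ≰∞⇒≥ λ { (fin≤fin a≤b) → a≰b a≤b }

  min∞-≤ʳ : ∀ a b → min∞ a b ≤∞ b
  min∞-≤ʳ ∞ b = ≤∞-refl b
  min∞-≤ʳ (fin a) ∞ = _ ≤∞top
  min∞-≤ʳ (fin a) (fin b) with a ≤? b
  ... | yes a≤b = fin≤fin a≤b
  ... | no  _   = ≤∞-refl (fin b)

  ≤-min∞ : ∀ {t} a b → t ≤∞ a → t ≤∞ b → t ≤∞ min∞ a b
  ≤-min∞ ∞ b _ q = q
  ≤-min∞ (fin a) ∞ p _ = p
  ≤-min∞ (fin a) (fin b) p q with a ≤? b
  ... | yes _ = p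
  ... | no  _ = q

  module ℝΣ = FiniteSums ℝ∞-commutativeMonoid
  open ℝΣ.Monotone _≤∞_ ≤∞-refl +∞-mono-≤ using (sum-mono)

  sumℝ∞≡sum : ∀ {n} (g : Fin n → ℝ∞) → sumℝ∞ g ≡ ℝΣ.sum g
  sumℝ∞≡sum {zero}  g = refl
  sumℝ∞≡sum {suc n} g = cong (g zero +∞_) (sumℝ∞≡sum (g ∘ suc))

  open Extremum _≤∞_ ≤∞-refl ≤∞-trans ≤∞-total renaming (best to argmin)
  open Extremum (λ a b → b ≤∞ a) ≤∞-refl (λ p q → ≤∞-trans q p) (λ a b → ≤∞-total b a)
    renaming (best to argmax)

  count : ∀ {m} → ℝ∞ → (Fin m → ℝ∞) → ℕ
  count t g = size (λ k → ⌊ t ≤∞? g k ⌋)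

  count-full : ∀ {m} (g : Fin m → ℝ∞) t → (∀ k → t ≤∞ g k) → count t g ≡ m
  count-full {zero}  g t _     = refl
  count-full {suc m} g t all-t = cong₂ ℕ._+_ (cong 𝟙 (⌊⌋-true (t ≤∞? g zero) (all-t zero)))
                                             (count-full (g ∘ suc) t (all-t ∘ suc))

  count-++ : ∀ {m m′} (g : Fin m → ℝ∞) (g′ : Fin m′ → ℝ∞) t → count t (g ++ g′) ≡ count t g ℕ.+ count t g′
  count-++ g g′ t = trans (ℕΣ.sum-cong-≗ (∘-++ (λ v → 𝟙 ⌊ t ≤∞? v ⌋) g g′)) (ℕΣ.sum-++ (λ k → 𝟙 ⌊ t ≤∞? g k ⌋) (λ k → 𝟙 ⌊ t ≤∞? g′ k ⌋))

  sum-nonneg : ∀ {m} (g : Fin m → ℝ∞) → (∀ k → fin 0# ≤∞ g k) → fin 0# ≤∞ ℝΣ.sum g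
  sum-nonneg {m} g nonneg = subst (_≤∞ ℝΣ.sum g) (ℝΣ.sum-zero {m} (λ _ → fin 0#) (λ _ → refl)) (sum-mono nonneg)

  -- A largest term of g is
  -- matched with a term of g′ above it; both are removed and we recurse.
  dominance : ∀ {m m′} (g : Fin m → ℝ∞) (g′ : Fin m′ → ℝ∞) → (∀ k → fin 0# ≤∞ g′ k) →
              (∀ t → count t g ℕ.≤ count t g′) → ℝΣ.sum g ≤∞ ℝΣ.sum g′
  dominance {zero} g g′ nonneg _ = sum-nonneg g′ nonneg
  dominance {suc m} {m′} g g′ nonneg counts
    with argmax {P = λ _ → ⊤} (λ _ → yes tt) g (zero , tt)
  ... | a , _ , a-max
    with size-witness (λ k → ⌊ g a ≤∞? g′ k ⌋)
           (ℕ.≤-trans (size-pos (λ k → ⌊ g a ≤∞? g k ⌋) a (⌊⌋-true (g a ≤∞? g a) (≤∞-refl (g a))))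
                      (counts (g a)))
  dominance {suc m} {suc m′} g g′ nonneg counts | a , _ , a-max | b , ga≤g′b′ = begin
    ℝΣ.sum g                        ≡⟨ ℝΣ.sum-remove {i = a} g ⟩
    g a +∞ ℝΣ.sum (removeAt g a)    ≲⟨ +∞-mono-≤ ga≤g′b (dominance (removeAt g a) (removeAt g′ b)
                                                           (nonneg ∘ _) counts-rest) ⟩
    g′ b +∞ ℝΣ.sum (removeAt g′ b)  ≡⟨ sym (ℝΣ.sum-remove {i = b} g′) ⟩
    ℝΣ.sum g′                       ∎
    where
    open ≤∞-Reasoning
    ga≤g′b : g a ≤∞ g′ b
    ga≤g′b = ⌊⌋-sound (g a ≤∞? g′ b) ga≤g′b′

    count-remove : ∀ {m} (h : Fin (suc m) → ℝ∞) (c : Fin (suc m)) t →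
                   t ≤∞ h c → count t h ≡ suc (count t (removeAt h c))
    count-remove h c t t≤hc =
      trans (ℕΣ.sum-remove {i = c} (λ k → if ⌊ t ≤∞? h k ⌋ then 1 else 0))
            (cong (λ β → (if β then 1 else 0) ℕ.+ count t (removeAt h c)) (⌊⌋-true (t ≤∞? h c) t≤hc))

    counts-rest : ∀ t → count t (removeAt g a) ℕ.≤ count t (removeAt g′ b)
    counts-rest t with t ≤∞? g a
    ... | yes t≤ga = ℕ.s≤s⁻¹ (subst₂ ℕ._≤_ (count-remove g a t t≤ga)
                                           (count-remove g′ b t (≤∞-trans t≤ga ga≤g′b)) (counts t))
    ... | no  t≰ga = subst (ℕ._≤ _) (sym (ℕΣ.sum-zero {m} _ none)) ℕ.z≤n
      where
      none : ∀ k → (if ⌊ t ≤∞? removeAt g a k ⌋ then 1 else 0) ≡ 0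
      none k = cong (λ β → if β then 1 else 0)
                    (⌊⌋-false (t ≤∞? removeAt g a k) λ t≤gk → t≰ga (≤∞-trans t≤gk (a-max _ tt)))

  -- Condition (i) of the theorem says
  -- that H is an ultrametric similarity: t ≤ H a b and t ≤ H b c give
  -- t ≤ H a c.  Setting the diagonal to ∞, "t ≤ D a b" is an equivalence
  -- relation for every t, whose classes are the clusters at level t.
  module Clusters {n} (H : Fin n → Fin n → ℝ∞) (H-sym : ∀ a b → a ≢ b → H a b ≡ H b a)
    (H-ultra : ∀ {t} a b c → a ≢ b → b ≢ c → a ≢ c → t ≤∞ H a b → t ≤∞ H b c → t ≤∞ H a c) where

    D : Fin n → Fin n → ℝ∞
    D a b = if ⌊ a ≟ b ⌋ then ∞ else H a b

    D-diag : ∀ a → D a a ≡ ∞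
    D-diag a = cong (if_then ∞ else H a a) (⌊⌋-true (a ≟ a) refl)

    D-off : ∀ {a b} → a ≢ b → D a b ≡ H a b
    D-off {a} {b} a≢b = cong (if_then ∞ else H a b) (⌊⌋-false (a ≟ b) a≢b)

    D-sym : ∀ a b → D a b ≡ D b a
    D-sym a b with a ≟ b | b ≟ a
    ... | yes _   | yes _   = refl
    ... | yes a≡b | no b≢a  = ⊥-elim (b≢a (sym a≡b))
    ... | no a≢b  | yes b≡a = ⊥-elim (a≢b (sym b≡a))
    ... | no a≢b  | no _    = H-sym a b a≢b

    D-ultra : ∀ {t} a b c → t ≤∞ D a b → t ≤∞ D b c → t ≤∞ D a c
    D-ultra {t} a b c t≤ab t≤bc with a ≟ c
    ... | yes refl = t ≤∞top
    ... | no a≢c   = distinct-ends a≢c t≤ab t≤bc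
      where
      distinct-ends : ∀ {a b c} → a ≢ c → t ≤∞ D a b → t ≤∞ D b c → t ≤∞ H a c
      distinct-ends {a} {b} {c} a≢c t≤ab t≤bc with a ≟ b
      ... | yes refl = subst (t ≤∞_) (D-off a≢c) t≤bc
      ... | no a≢b with b ≟ c
      ...   | yes refl = t≤ab
      ...   | no b≢c   = H-ultra a b c a≢b b≢c a≢c t≤ab t≤bc

    cluster : Fin n → ℝ∞ → Fin n → Bool
    cluster c t a = ⌊ t ≤∞? D c a ⌋

    cluster-centre : ∀ c t → cluster c t c ≡ true
    cluster-centre c t = ⌊⌋-true (t ≤∞? D c c) (subst (t ≤∞_) (sym (D-diag c)) (t ≤∞top))

    cluster-recentre : ∀ {a b t} → t ≤∞ D a b → cluster a t ≗ cluster b t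
    cluster-recentre {a} {b} {t} t≤ab c =
      ⌊⌋-cong (t ≤∞? D a c) (t ≤∞? D b c)
              (D-ultra b a c (subst (t ≤∞_) (D-sym a b) t≤ab))
              (D-ultra a b c t≤ab)

    cluster-level : ∀ c t → Σ (Fin n) λ a → t ≤∞ D c a × cluster c t ≗ cluster c (D c a)
    cluster-level c t with argmin (λ a → t ≤∞? D c a) (D c) (c , subst (t ≤∞_) (sym (D-diag c)) (t ≤∞top))
    ... | a , t≤ca , a-min = a , t≤ca , λ b →
          ⌊⌋-cong (t ≤∞? D c b) (D c a ≤∞? D c b) (a-min b) (≤∞-trans t≤ca)

    -- Integer weights w ≤ 1 and a point i; S c t is the weight of the
    -- cluster of c at level t.  A set is heavy if its weight is ≥ 1 and
    -- light if it is ≤ 0.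
    module Exchange (w : Fin n → ℤ) (w≤1 : ∀ a → w a ℤ.≤ 1ℤ) (i : Fin n) where
      open Weights w w≤1

      S : Fin n → ℝ∞ → ℤ
      S c t = weight (cluster c t)

      S-recentre : ∀ {a b t} → t ≤∞ D a b → S a t ≡ S b t
      S-recentre t≤ab = ℤΣ.sumOver-cong w (cluster-recentre t≤ab)

      heavy-point : ∀ c t → 1ℤ ℤ.≤ S c t →
                    Σ (Fin n) λ a → w a ≡ 1ℤ × t ≤∞ D c a × S c t ℤ.≤ S c (D c a)
      heavy-point c t heavy with any? (λ a → (w a ℤ.≟ 1ℤ) ×-dec (t ≤∞? D c a))
      ... | no none = ⊥-elim (1≰0 heavy (weight-nonpos (cluster c t)
                        λ a in-c wa → none (a , wa , ⌊⌋-sound (t ≤∞? D c a) in-c)))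
      ... | yes some with argmin (λ a → (w a ℤ.≟ 1ℤ) ×-dec (t ≤∞? D c a)) (D c) some
      ...   | a , (wa , t≤ca) , a-min = a , wa , t≤ca , weight-mono (cluster c t) (cluster c (D c a)) inner keep
        where
        inner : ∀ b → cluster c (D c a) b ≡ true → cluster c t b ≡ true
        inner b in-a = ⌊⌋-true (t ≤∞? D c b) (≤∞-trans t≤ca (⌊⌋-sound (D c a ≤∞? D c b) in-a))
        keep : ∀ b → cluster c t b ≡ true → cluster c (D c a) b ≡ false → w b ≢ 1ℤ
        keep b in-t out-a wb = true≢false (trans (sym (⌊⌋-true (D c a ≤∞? D c b)
                                 (a-min b (wb , ⌊⌋-sound (t ≤∞? D c b) in-t)))) out-a)

      Candidate : Fin n → Set
      Candidate a = w a ≡ 1ℤ × 1ℤ ℤ.≤ S i (D i a)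

      candidate? : ∀ a → Dec (Candidate a)
      candidate? a = (w a ℤ.≟ 1ℤ) ×-dec (1ℤ ℤ.≤? S i (D i a))

      -- j outweighs i: at every level the cluster of j is heavier than that
      -- of i by at least one, unless the two clusters coincide.
      Outweighs : Fin n → Set
      Outweighs j = ∀ t → S i t ℤ.+ 1ℤ ℤ.≤ S j t ℤ.+ + 𝟙 (cluster i t j)

      -- Let the cluster Top of i at level τ be heavy while all smaller clusters
      -- of i are light.  Then some positive point of Top outweighs i.
      module TopCluster (τ : ℝ∞) (heavy : 1ℤ ℤ.≤ S i τ)
                        (light-above : ∀ t → ¬ (t ≤∞ τ) → S i t ℤ.≤ 0ℤ) where
        Top : Fin n → Bool
        Top = cluster i τ

        Bad : Fin n → ℝ∞ → Set
        Bad q t = ¬ (t ≤∞ D i q) × S q t ℤ.≤ 0ℤ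

        BadAt? : ∀ q a → Dec (Bad q (D q a))
        BadAt? q a = ¬? (D q a ≤∞? D i q) ×-dec (S q (D q a) ℤ.≤? 0ℤ)

        bad-level : ∀ {q t} → Bad q t → Σ (Fin n) λ a → Bad q (D q a) × t ≤∞ D q a ×
                                         (∀ b → t ≤∞ D q b → D q a ≤∞ D q b)
        bad-level {q} {t} (t≰iq , light) with cluster-level q t
        ... | a , t≤qa , same =
              a , ((λ le → t≰iq (≤∞-trans t≤qa le)) , subst (ℤ._≤ 0ℤ) (ℤΣ.sumOver-cong w same) light)
                , t≤qa , λ b t≤qb → ⌊⌋-sound (D q a ≤∞? D q b) (trans (sym (same b)) (⌊⌋-true (t ≤∞? D q b) t≤qb))

        Good : Fin n → Set
        Good q = w q ≡ 1ℤ × Top q ≡ true × ¬ (∃ λ a → Bad q (D q a))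

        Good? : ∀ q → Dec (Good q)
        Good? q = (w q ℤ.≟ 1ℤ) ×-dec ((Top q Bool.≟ true) ×-dec ¬? (any? (BadAt? q)))

        good⇒outweighs : ∀ j → Good j → Outweighs j
        good⇒outweighs j (wj , Top-j , no-bad) t with t ≤∞? D i j
        ... | yes t≤ij = ℤ.≤-reflexive (cong (ℤ._+ 1ℤ) (S-recentre t≤ij))
        ... | no  t≰ij = begin
              S i t ℤ.+ 1ℤ   ≤⟨ ℤ.+-monoˡ-≤ 1ℤ (light-above t λ t≤τ → t≰ij (≤∞-trans t≤τ τ≤ij)) ⟩
              1ℤ             ≤⟨ ≰0⇒≥1 j-heavy ⟩
              S j t          ≡⟨ sym (ℤ.+-identityʳ (S j t)) ⟩
              S j t ℤ.+ 0ℤ   ∎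
          where
          open ℤ.≤-Reasoning
          τ≤ij = ⌊⌋-sound (τ ≤∞? D i j) Top-j
          j-heavy : ¬ (S j t ℤ.≤ 0ℤ)
          j-heavy light = let a , bad , _ = bad-level (t≰ij , light) in no-bad (a , bad)

        MaximalBad : Fin n → ℝ∞ → Set
        MaximalBad q T = Bad q T × (∀ t → Bad q t → ∀ b → t ≤∞ D q b → T ≤∞ D q b)

        maximal-bad : ∀ q → ∃ (λ a → Bad q (D q a)) → Σ ℝ∞ (MaximalBad q)
        maximal-bad q some with argmin (BadAt? q) (D q) some
        ... | a , bad-a , a-min = D q a , bad-a , λ t bad b t≤qb →
              let a′ , bad-a′ , _ , a′-below = bad-level bad in
              ≤∞-trans (a-min a′ bad-a′) (a′-below b t≤qb)

        -- If every positive point of Top had bad levels, the maximal bad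
        -- clusters would be blocks covering Top, so Top would be light.
        module AllBad (all-bad : ∀ q → w q ≡ 1ℤ → Top q ≡ true → ∃ λ a → Bad q (D q a)) where
          threshold : Fin n → ℝ∞
          threshold q with any? (BadAt? q)
          ... | yes some = proj₁ (maximal-bad q some)
          ... | no  _    = ∞

          threshold-maximal : ∀ q → w q ≡ 1ℤ → Top q ≡ true → MaximalBad q (threshold q)
          threshold-maximal q wq Topq with any? (BadAt? q)
          ... | yes some = proj₂ (maximal-bad q some)
          ... | no  none = ⊥-elim (none (all-bad q wq Topq))

          block : Fin n → Fin n → Bool
          block q = cluster q (threshold q)

          block-light : ∀ q → Top q ≡ true → w q ≡ 1ℤ → weight (block q) ℤ.≤ 0ℤ
          block-light q Topq wq = proj₂ (proj₁ (threshold-maximal q wq Topq))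

          block⊆Top : ∀ q → Top q ≡ true → w q ≡ 1ℤ → ∀ b → block q b ≡ true → Top b ≡ true
          block⊆Top q Topq wq b in-block = ⌊⌋-true (τ ≤∞? D i b) (D-ultra i q b τ≤iq τ≤qb)
            where
            τ≤iq = ⌊⌋-sound (τ ≤∞? D i q) Topq
            iq≤T = ≰∞⇒≥ (proj₁ (proj₁ (threshold-maximal q wq Topq)))
            τ≤qb = ≤∞-trans τ≤iq (≤∞-trans iq≤T (⌊⌋-sound (threshold q ≤∞? D q b) in-block))

          -- Two blocks that meet: the one with the lower threshold contains
          -- the other; in the other case its threshold is bad for both.
          block-meet : ∀ q q′ → Top q ≡ true → w q ≡ 1ℤ → Top q′ ≡ true → w q′ ≡ 1ℤ →
                       ∀ b → block q b ≡ true → block q′ b ≡ true → block q q′ ≡ true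
          block-meet q q′ Topq wq Topq′ wq′ b in-q in-q′ with ≤∞-total (threshold q) (threshold q′)
          ... | inj₁ T≤T′ = ⌊⌋-true (T ≤∞? D q q′) (D-ultra q b q′ T≤qb (≤∞-trans T≤T′ T′≤bq′))
            where
            T = threshold q ; T′ = threshold q′
            T≤qb = ⌊⌋-sound (T ≤∞? D q b) in-q
            T′≤bq′ = subst (T′ ≤∞_) (D-sym q′ b) (⌊⌋-sound (T′ ≤∞? D q′ b) in-q′)
          ... | inj₂ T′≤T = ⌊⌋-true (T ≤∞? D q q′) (proj₂ (threshold-maximal q wq Topq) T′ T′-bad q′ T′≤qq′)
            where
            T = threshold q ; T′ = threshold q′
            bad′ = proj₁ (threshold-maximal q′ wq′ Topq′)
            T′≤qq′ = D-ultra q b q′ (≤∞-trans T′≤T (⌊⌋-sound (T ≤∞? D q b) in-q))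
                                    (subst (T′ ≤∞_) (D-sym q′ b) (⌊⌋-sound (T′ ≤∞? D q′ b) in-q′))
            T′-bad : Bad q T′
            T′-bad = (λ T′≤iq → proj₁ bad′ (D-ultra i q q′ T′≤iq T′≤qq′))
                   , subst (ℤ._≤ 0ℤ) (S-recentre (subst (T′ ≤∞_) (D-sym q q′) T′≤qq′)) (proj₂ bad′)

          impossible : ⊥
          impossible = 1≰0 heavy
            (Cover.cover Top block (λ q _ _ → cluster-centre q (threshold q)) block-light block-meet
                         (size Top) Top ℕ.≤-refl (λ _ Topq → Topq) block⊆Top)

        good-point : Σ (Fin n) λ j → w j ≡ 1ℤ × Outweighs j
        good-point with any? Good?
        ... | yes (j , good@(wj , _)) = j , wj , good⇒outweighs j good
        ... | no  none = ⊥-elim (AllBad.impossible all-bad)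
          where
          all-bad : ∀ q → w q ≡ 1ℤ → Top q ≡ true → ∃ λ a → Bad q (D q a)
          all-bad q wq Topq with any? (BadAt? q)
          ... | yes some = some
          ... | no  no-bad = ⊥-elim (none (q , wq , Topq , no-bad))

      -- Every heavy cluster of i lies below the level of a candidate, so a
      -- level that no candidate reaches gives a light cluster.
      light-unless-candidate : ∀ t → (∀ a → Candidate a → ¬ (t ≤∞ D i a)) → S i t ℤ.≤ 0ℤ
      light-unless-candidate t unreached with 1ℤ ℤ.≤? S i t
      ... | no  ¬heavy = ≱1⇒≤0 ¬heavy
      ... | yes heavy  = let a , wa , t≤ia , le = heavy-point i t heavy in
                         ⊥-elim (unreached a (wa , ℤ.≤-trans heavy le) t≤ia)

      -- In the second case the cluster of i at the
      -- highest candidate level is heavy while all smaller ones are light.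
      exchange : (∀ t → S i t ℤ.≤ 0ℤ) ⊎ Σ (Fin n) λ j → w j ≡ 1ℤ × Outweighs j
      exchange with any? candidate?
      ... | no  none = inj₁ λ t → light-unless-candidate t λ a cand _ → none (a , cand)
      ... | yes some with argmax candidate? (D i) some
      ...   | a₀ , (_ , a₀-heavy) , a₀-max = inj₂ (TopCluster.good-point (D i a₀) a₀-heavy λ t t≰ia₀ →
                light-unless-candidate t λ a cand t≤ia → t≰ia₀ (≤∞-trans t≤ia (a₀-max a cand)))

  module _ {n} (x : Cube n) (i : Fin n) where
    moveOut-i : ∀ j → moveOut x i j i ≡ false
    moveOut-i j with i ≟ i
    ... | yes _   = refl
    ... | no  i≢i = ⊥-elim (i≢i refl)

    moveIn-i : ∀ j → moveIn x i j i ≡ true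
    moveIn-i j with i ≟ i
    ... | yes _   = refl
    ... | no  i≢i = ⊥-elim (i≢i refl)

    moveOut-nothing : ∀ {k} → k ≢ i → moveOut x i nothing k ≡ x k
    moveOut-nothing {k} k≢i with k ≟ i
    ... | yes k≡i = ⊥-elim (k≢i k≡i)
    ... | no  _   = refl

    moveIn-nothing : ∀ {k} → k ≢ i → moveIn x i nothing k ≡ x k
    moveIn-nothing {k} k≢i with k ≟ i
    ... | yes k≡i = ⊥-elim (k≢i k≡i)
    ... | no  _   = refl

    moveOut-j : ∀ {j} → j ≢ i → moveOut x i (just j) j ≡ true
    moveOut-j {j} j≢i with j ≟ i
    ... | yes j≡i = ⊥-elim (j≢i j≡i)
    ... | no  _   = cong (if_then true else x j) (⌊⌋-true (j ≟ j) refl)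

    moveIn-j : ∀ {j} → j ≢ i → moveIn x i (just j) j ≡ false
    moveIn-j {j} j≢i with j ≟ i
    ... | yes j≡i = ⊥-elim (j≢i j≡i)
    ... | no  _   = cong (if_then false else x j) (⌊⌋-true (j ≟ j) refl)

    moveOut-false : ∀ j {c} → (c ≢ i → moveOut x i j c ≡ false) → moveOut x i j c ≡ false
    moveOut-false j {c} off = by-cases (c ≟ i)
      where
      by-cases : Dec (c ≡ i) → moveOut x i j c ≡ false
      by-cases (yes refl) = moveOut-i j
      by-cases (no c≢i)   = off c≢i

    moveOut-just : ∀ {j k} → k ≢ i → k ≢ j → moveOut x i (just j) k ≡ x k
    moveOut-just {j} {k} k≢i k≢j with k ≟ i
    ... | yes k≡i = ⊥-elim (k≢i k≡i)
    ... | no  _   = cong (if_then true else x k) (⌊⌋-false (k ≟ j) k≢j)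

    moveIn-just : ∀ {j k} → k ≢ i → k ≢ j → moveIn x i (just j) k ≡ x k
    moveIn-just {j} {k} k≢i k≢j with k ≟ i
    ... | yes k≡i = ⊥-elim (k≢i k≡i)
    ... | no  _   = cong (if_then false else x k) (⌊⌋-false (k ≟ j) k≢j)

  record Inserts {n} (x′ x : Cube n) (k : Fin n) : Set where
    field
      absent    : x k ≡ false
      present   : x′ k ≡ true
      unchanged : ∀ a → a ≢ k → x′ a ≡ x a

  module _ {n} {x : Cube n} {i : Fin n} where
    remove-point : x i ≡ true → Inserts x (moveOut x i nothing) i
    remove-point xi = record { absent = moveOut-i x i nothing ; present = xi
                             ; unchanged = λ a a≢i → sym (moveOut-nothing x i a≢i) }

    add-point : x i ≡ false → Inserts (moveIn x i nothing) x i
    add-point xi = record { absent = xi ; present = moveIn-i x i nothing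
                          ; unchanged = λ a → moveIn-nothing x i }

    swap-out : ∀ {j} → j ≢ i → x j ≡ false → Inserts (moveOut x i (just j)) (moveOut x i nothing) j
    swap-out {j} j≢i xj = record
      { absent = trans (moveOut-nothing x i j≢i) xj ; present = moveOut-j x i j≢i
      ; unchanged = λ a a≢j → by-cases a a≢j (a ≟ i) }
      where
      by-cases : ∀ a → a ≢ j → Dec (a ≡ i) → moveOut x i (just j) a ≡ moveOut x i nothing a
      by-cases a a≢j (yes refl) = trans (moveOut-i x a (just j)) (sym (moveOut-i x a nothing))
      by-cases a a≢j (no a≢i)   = trans (moveOut-just x i a≢i a≢j) (sym (moveOut-nothing x i a≢i))

    swap-in : ∀ {j} → j ≢ i → x i ≡ false → Inserts (moveIn x i (just j)) (moveOut x j nothing) i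
    swap-in {j} j≢i xi = record
      { absent = trans (moveOut-nothing x j (j≢i ∘ sym)) xi ; present = moveIn-i x i (just j)
      ; unchanged = λ a a≢i → by-cases a a≢i (a ≟ j) }
      where
      by-cases : ∀ a → a ≢ i → Dec (a ≡ j) → moveIn x i (just j) a ≡ moveOut x j nothing a
      by-cases a a≢i (yes refl) = trans (moveIn-j x i j≢i) (sym (moveOut-i x a nothing))
      by-cases a a≢i (no a≢j)   = trans (moveIn-just x i a≢i a≢j) (sym (moveOut-nothing x j a≢j))

  module Quadratic {n} (h : Fin n → Carrier) (H : Fin n → Fin n → ℝ∞)
                   (H-sym : ∀ i j → i ≢ j → H i j ≡ H j i) where

    f : Cube n → ℝ∞
    f = quadFun h H

    lt : Fin n → Fin n → Bool
    lt i j = ⌊ toℕ i <ℕ? toℕ j ⌋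

    lt-irrefl : ∀ i → lt i i ≡ false
    lt-irrefl i = ⌊⌋-false (toℕ i <ℕ? toℕ i) (ℕ.<-irrefl refl)

    pair-term : Cube n → Fin n → Fin n → ℝ∞
    pair-term x i j = scale (lt i j ∧ x i ∧ x j) (H i j)

    linear quadratic : Cube n → ℝ∞
    linear x    = ℝΣ.sum (λ a → scale (x a) (fin (h a)))
    quadratic x = ℝΣ.sum (λ i → ℝΣ.sum (pair-term x i))

    f-split : ∀ x → f x ≡ linear x +∞ quadratic x
    f-split x = cong₂ _+∞_ (sumℝ∞≡sum (λ a → scale (x a) (fin (h a))))
                  (trans (sumℝ∞≡sum (λ i → sumℝ∞ (pair-term x i))) (ℝΣ.sum-cong-≗ (λ i → sumℝ∞≡sum (pair-term x i))))

    δ : Cube n → Fin n → ℝ∞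
    δ x k = ℝΣ.sum (λ a → scale (x a) (H k a))

    module _ {x′ x : Cube n} {k : Fin n} (ins : Inserts x′ x k) where
      open Inserts ins

      linear-insert : linear x′ ≡ linear x +∞ fin (h k)
      linear-insert = ℝΣ.sum-update _ _ k (fin (h k))
        (λ a a≢k → cong (λ b → scale b (fin (h a))) (unchanged a a≢k))
        (trans (cong (λ b → scale b (fin (h k))) present)
               (sym (trans (cong (λ b → scale b (fin (h k)) +∞ fin (h k)) absent) (+∞-identityˡ _))))

      below : Fin n → ℝ∞
      below i = scale (lt i k ∧ x i) (H i k)

      above : ℝ∞
      above = ℝΣ.sum (λ j → scale (lt k j ∧ x j) (H k j))

      below-k : below k ≡ fin 0#
      below-k = cong (λ b → scale b (H k k)) (cong (_∧ x k) (lt-irrefl k))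

      row-insert : ∀ i → i ≢ k → ℝΣ.sum (pair-term x′ i) ≡ ℝΣ.sum (pair-term x i) +∞ below i
      row-insert i i≢k = ℝΣ.sum-update _ _ k (below i)
        (λ j j≢k → cong₂ (λ b c → scale (lt i j ∧ b ∧ c) (H i j)) (unchanged i i≢k) (unchanged j j≢k))
        at-k
        where
        at-k : pair-term x′ i k ≡ pair-term x i k +∞ below i
        at-k rewrite present | absent | unchanged i i≢k | Bool.∧-identityʳ (x i)
                   | Bool.∧-zeroʳ (x i) | Bool.∧-zeroʳ (lt i k) = sym (+∞-identityˡ _)

      row-k-insert : ℝΣ.sum (pair-term x′ k) ≡ ℝΣ.sum (pair-term x k) +∞ above
      row-k-insert = trans (ℝΣ.sum-cong-≗ new-row)
                           (sym (trans (cong (_+∞ above) (ℝΣ.sum-zero (pair-term x k) old-row)) (+∞-identityˡ above)))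
        where
        old-row : ∀ j → pair-term x k j ≡ fin 0#
        old-row j rewrite absent | Bool.∧-zeroʳ (lt k j) = refl
        new-row : ∀ j → pair-term x′ k j ≡ scale (lt k j ∧ x j) (H k j)
        new-row j rewrite present with j ≟ k
        ... | yes refl rewrite lt-irrefl j = refl
        ... | no  j≢k  rewrite unchanged j j≢k = refl

      δ-split : δ x k ≡ ℝΣ.sum below +∞ above
      δ-split = trans (ℝΣ.sum-cong-≗ term) (ℝΣ.∑-distrib-+ below _)
        where
        term : ∀ a → scale (x a) (H k a) ≡ below a +∞ scale (lt k a ∧ x a) (H k a)
        term a with a ≟ k
        ... | yes refl rewrite absent | Bool.∧-zeroʳ (lt a a) = sym (+∞-identityˡ _)
        ... | no  a≢k with x a
        ...   | false rewrite Bool.∧-zeroʳ (lt a k) | Bool.∧-zeroʳ (lt k a) = sym (+∞-identityˡ _)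
        ...   | true rewrite Bool.∧-identityʳ (lt a k) | Bool.∧-identityʳ (lt k a)
                with ℕ.<-cmp (toℕ a) (toℕ k)
        ...     | tri< a<k _ k≮a rewrite ⌊⌋-true (toℕ a <ℕ? toℕ k) a<k | ⌊⌋-false (toℕ k <ℕ? toℕ a) k≮a =
                    trans (H-sym k a (a≢k ∘ sym)) (sym (+∞-identityʳ _))
        ...     | tri≈ _ a≡k _ = ⊥-elim (a≢k (toℕ-injective a≡k))
        ...     | tri> a≮k _ k<a rewrite ⌊⌋-false (toℕ a <ℕ? toℕ k) a≮k | ⌊⌋-true (toℕ k <ℕ? toℕ a) k<a =
                    sym (+∞-identityˡ _)

      quadratic-insert : quadratic x′ ≡ quadratic x +∞ δ x k
      quadratic-insert = begin
        quadratic x′                                         ≡⟨ ℝΣ.sum-update _ _ k above row-insert at-k ⟩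
        ℝΣ.sum (λ i → ℝΣ.sum (pair-term x i) +∞ below i) +∞ above ≡⟨ cong (_+∞ above) (ℝΣ.∑-distrib-+ _ below) ⟩
        (quadratic x +∞ ℝΣ.sum below) +∞ above               ≡⟨ +∞-assoc _ _ _ ⟩
        quadratic x +∞ (ℝΣ.sum below +∞ above)               ≡⟨ cong (quadratic x +∞_) (sym δ-split) ⟩
        quadratic x +∞ δ x k                                 ∎
        where
        open ≡-Reasoning
        at-k : ℝΣ.sum (pair-term x′ k) ≡ (ℝΣ.sum (pair-term x k) +∞ below k) +∞ above
        at-k = trans row-k-insert
                 (cong (_+∞ above) (sym (trans (cong (ℝΣ.sum (pair-term x k) +∞_) below-k) (+∞-identityʳ _))))

      f-insert : f x′ ≡ f x +∞ (fin (h k) +∞ δ x k)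
      f-insert = begin
        f x′                                              ≡⟨ f-split x′ ⟩
        linear x′ +∞ quadratic x′                         ≡⟨ cong₂ _+∞_ linear-insert quadratic-insert ⟩
        (linear x +∞ fin (h k)) +∞ (quadratic x +∞ δ x k) ≡⟨ solve 4 (λ a b c d → (a ⊕ b) ⊕ (c ⊕ d) ⊜ (a ⊕ c) ⊕ (b ⊕ d))
                                                                   refl (linear x) (fin (h k)) (quadratic x) (δ x k) ⟩
        (linear x +∞ quadratic x) +∞ (fin (h k) +∞ δ x k) ≡⟨ cong (_+∞ (fin (h k) +∞ δ x k)) (sym (f-split x)) ⟩
        f x +∞ (fin (h k) +∞ δ x k)                       ∎
        where
        open ≡-Reasoning
        open CMSolver ℝ∞-commutativeMonoid

    ∅ : Cube n
    ∅ _ = false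

    single : Fin n → Cube n
    single a c = ⌊ c ≟ a ⌋

    ⟦_,_⟧ : Fin n → Fin n → Cube n
    ⟦ a , b ⟧ c = ⌊ c ≟ a ⌋ ∨ ⌊ c ≟ b ⌋

    single-in : ∀ a → single a a ≡ true
    single-in a = ⌊⌋-true (a ≟ a) refl

    single-out : ∀ {a c} → c ≢ a → single a c ≡ false
    single-out {a} {c} = ⌊⌋-false (c ≟ a)

    ⟦,⟧-inˡ : ∀ a b → ⟦ a , b ⟧ a ≡ true
    ⟦,⟧-inˡ a b = cong (_∨ ⌊ a ≟ b ⌋) (single-in a)

    ⟦,⟧-inʳ : ∀ a b → ⟦ a , b ⟧ b ≡ true
    ⟦,⟧-inʳ a b = trans (cong (⌊ b ≟ a ⌋ ∨_) (single-in b)) (Bool.∨-zeroʳ _)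

    ⟦,⟧-out : ∀ {a b c} → c ≢ a → c ≢ b → ⟦ a , b ⟧ c ≡ false
    ⟦,⟧-out c≢a c≢b = cong₂ _∨_ (single-out c≢a) (single-out c≢b)

    f-∅ : f ∅ ≡ fin 0#
    f-∅ = trans (f-split ∅)
            (trans (cong₂ _+∞_ (ℝΣ.sum-zero (λ a → scale false (fin (h a))) (λ _ → refl))
                               (ℝΣ.sum-zero (λ i → ℝΣ.sum (pair-term ∅ i)) λ i → ℝΣ.sum-zero (pair-term ∅ i) λ j →
                                  cong (λ b → scale b (H i j)) (Bool.∧-zeroʳ (lt i j))))
                   (+∞-identityˡ (fin 0#)))

    f-singleton : ∀ {x a} → x a ≡ true → (∀ c → c ≢ a → x c ≡ false) → f x ≡ fin (h a)
    f-singleton {x} {a} xa off = begin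
      f x                                   ≡⟨ f-insert (record { absent = refl ; present = xa ; unchanged = off }) ⟩
      f ∅ +∞ (fin (h a) +∞ δ ∅ a)           ≡⟨ cong₂ (λ u v → u +∞ (fin (h a) +∞ v)) f-∅ (ℝΣ.sum-zero (λ c → scale false (H a c)) (λ _ → refl)) ⟩
      fin 0# +∞ (fin (h a) +∞ fin 0#)       ≡⟨ trans (+∞-identityˡ _) (+∞-identityʳ _) ⟩
      fin (h a)                             ∎
      where open ≡-Reasoning

    f-doubleton : ∀ {x a b} → a ≢ b → x a ≡ true → x b ≡ true → (∀ c → c ≢ a → c ≢ b → x c ≡ false) →
                  f x ≡ fin (h b) +∞ (fin (h a) +∞ H a b)
    f-doubleton {x} {a} {b} a≢b xa xb off = begin
      f x                                           ≡⟨ f-insert (record { absent = single-out a≢b ; present = xa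
                                                                        ; unchanged = others }) ⟩
      f (single b) +∞ (fin (h a) +∞ δ (single b) a) ≡⟨ cong₂ (λ u v → u +∞ (fin (h a) +∞ v))
                                                         (f-singleton (single-in b) (λ c → single-out))
                                                         (ℝΣ.sum-point _ b (λ c c≢b → cong (λ β → scale β (H a c)) (single-out c≢b))) ⟩
      fin (h b) +∞ (fin (h a) +∞ scale (single b b) (H a b))
                                                    ≡⟨ cong (λ β → fin (h b) +∞ (fin (h a) +∞ scale β (H a b))) (single-in b) ⟩
      fin (h b) +∞ (fin (h a) +∞ H a b)             ∎
      where
      open ≡-Reasoning
      others : ∀ c → c ≢ a → x c ≡ single b c
      others c c≢a with c ≟ b
      ... | yes refl = xb
      ... | no  c≢b  = off c c≢a c≢b

    module Necessity (M : MNatConvex f) where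
      open CMSolver ℝ∞-commutativeMonoid using (solve; _⊕_; _⊜_)

      f-drop : ∀ {i j} → j ≢ i → f (moveOut ⟦ i , j ⟧ i nothing) ≡ fin (h j)
      f-drop {i} {j} j≢i = f-singleton (trans (moveOut-nothing _ i j≢i) (⟦,⟧-inʳ i j)) off
        where
        off : ∀ c → c ≢ j → moveOut ⟦ i , j ⟧ i nothing c ≡ false
        off c c≢j = moveOut-false _ i nothing λ c≢i → trans (moveOut-nothing _ i c≢i) (⟦,⟧-out c≢i c≢j)

      f-⟦,⟧ : ∀ {i j} → i ≢ j → f ⟦ i , j ⟧ ≡ fin (h j) +∞ (fin (h i) +∞ H i j)
      f-⟦,⟧ {i} {j} i≢j = f-doubleton i≢j (⟦,⟧-inˡ i j) (⟦,⟧-inʳ i j) (λ c → ⟦,⟧-out)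

      nonneg : ∀ i j → i ≢ j → fin 0# ≤∞ H i j
      nonneg i j i≢j with M ⟦ i , j ⟧ ∅ i (⟦,⟧-inˡ i j) refl
      ... | just m  , (() , _) , _
      ... | nothing , _ , ineq = +∞-cancelˡ-≤ (h j + h i) (subst₂ _≤∞_ lhs rhs ineq)
        where
        lhs : f (moveOut ⟦ i , j ⟧ i nothing) +∞ f (moveIn ∅ i nothing) ≡ fin (h j + h i) +∞ fin 0#
        lhs = trans (cong₂ _+∞_ (f-drop (i≢j ∘ sym)) (f-singleton (moveIn-i ∅ i nothing) (λ c → moveIn-nothing ∅ i)))
                    (sym (+∞-identityʳ _))
        rhs : f ⟦ i , j ⟧ +∞ f ∅ ≡ fin (h j + h i) +∞ H i j
        rhs = trans (cong₂ _+∞_ (f-⟦,⟧ i≢j) f-∅)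
                    (trans (+∞-identityʳ _) (sym (+∞-assoc (fin (h j)) (fin (h i)) (H i j))))

      ultrametric : ∀ i j k → i ≢ j → i ≢ k → j ≢ k → min∞ (H i k) (H j k) ≤∞ H i j
      ultrametric i j k i≢j i≢k j≢k with M ⟦ i , j ⟧ (single k) i (⟦,⟧-inˡ i j) (single-out i≢k)
      ... | nothing , _ , ineq =
            ≤∞-trans (min∞-≤ˡ (H i k) (H j k)) (+∞-cancelˡ-≤ ((h j + h k) + h i) (subst₂ _≤∞_ lhs rhs ineq))
        where
        added : f (moveIn (single k) i nothing) ≡ fin (h k) +∞ (fin (h i) +∞ H i k)
        added = f-doubleton i≢k (moveIn-i _ i nothing) (trans (moveIn-nothing _ i (i≢k ∘ sym)) (single-in k))
                  (λ c c≢i c≢k → trans (moveIn-nothing _ i c≢i) (single-out c≢k))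
        lhs : f (moveOut ⟦ i , j ⟧ i nothing) +∞ f (moveIn (single k) i nothing) ≡ fin ((h j + h k) + h i) +∞ H i k
        lhs = trans (cong₂ _+∞_ (f-drop (i≢j ∘ sym)) added)
                    (solve 4 (λ a b c d → a ⊕ (b ⊕ (c ⊕ d)) ⊜ ((a ⊕ b) ⊕ c) ⊕ d) refl
                             (fin (h j)) (fin (h k)) (fin (h i)) (H i k))
        rhs : f ⟦ i , j ⟧ +∞ f (single k) ≡ fin ((h j + h k) + h i) +∞ H i j
        rhs = trans (cong₂ _+∞_ (f-⟦,⟧ i≢j) (f-singleton (single-in k) (λ c → single-out)))
                    (solve 4 (λ a b c d → (a ⊕ (c ⊕ d)) ⊕ b ⊜ ((a ⊕ b) ⊕ c) ⊕ d) refl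
                             (fin (h j)) (fin (h k)) (fin (h i)) (H i j))
      ... | just m , (km , _) , ineq with ⌊⌋-sound (m ≟ k) km
      ...   | refl =
            ≤∞-trans (min∞-≤ʳ (H i m) (H j m)) (+∞-cancelˡ-≤ ((h j + h m) + h i) (subst₂ _≤∞_ lhs rhs ineq))
        where
        swapped : f (moveOut ⟦ i , j ⟧ i (just m)) ≡ fin (h m) +∞ (fin (h j) +∞ H j m)
        swapped = f-doubleton j≢k (trans (moveOut-just _ i (i≢j ∘ sym) j≢k) (⟦,⟧-inʳ i j))
                    (moveOut-j _ i (i≢k ∘ sym)) off
          where
          off : ∀ c → c ≢ j → c ≢ m → moveOut ⟦ i , j ⟧ i (just m) c ≡ false
          off c c≢j c≢m = moveOut-false _ i (just m) λ c≢i → trans (moveOut-just _ i c≢i c≢m) (⟦,⟧-out c≢i c≢j)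
        received : f (moveIn (single m) i (just m)) ≡ fin (h i)
        received = f-singleton (moveIn-i _ i (just m)) off
          where
          off : ∀ c → c ≢ i → moveIn (single m) i (just m) c ≡ false
          off c c≢i = by-cases (c ≟ m)
            where
            by-cases : Dec (c ≡ m) → moveIn (single m) i (just m) c ≡ false
            by-cases (yes refl) = moveIn-j _ i (i≢k ∘ sym)
            by-cases (no c≢m)   = trans (moveIn-just _ i c≢i c≢m) (single-out c≢m)
        lhs : f (moveOut ⟦ i , j ⟧ i (just m)) +∞ f (moveIn (single m) i (just m)) ≡ fin ((h j + h m) + h i) +∞ H j m
        lhs = trans (cong₂ _+∞_ swapped received)
                    (solve 4 (λ a b c d → (b ⊕ (a ⊕ d)) ⊕ c ⊜ ((a ⊕ b) ⊕ c) ⊕ d) refl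
                             (fin (h j)) (fin (h m)) (fin (h i)) (H j m))
        rhs : f ⟦ i , j ⟧ +∞ f (single m) ≡ fin ((h j + h m) + h i) +∞ H i j
        rhs = trans (cong₂ _+∞_ (f-⟦,⟧ i≢j) (f-singleton (single-in m) (λ c → single-out)))
                    (solve 4 (λ a b c d → (a ⊕ (c ⊕ d)) ⊕ b ⊜ ((a ⊕ b) ⊕ c) ⊕ d) refl
                             (fin (h j)) (fin (h m)) (fin (h i)) (H i j))

    size-insert : ∀ {x′ x : Cube n} {k} → Inserts x′ x k → ∀ U → size (x′ ∩ U) ≡ size (x ∩ U) ℕ.+ 𝟙 (U k)
    size-insert {x′} {x} {k} ins U =
      ℕΣ.sum-update (λ a → 𝟙 (x a ∧ U a)) (λ a → 𝟙 (x′ a ∧ U a)) k (𝟙 (U k))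
        (λ a a≢k → cong (λ b → 𝟙 (b ∧ U a)) (unchanged a a≢k))
        at-k
      where
      open Inserts ins
      at-k : 𝟙 (x′ k ∧ U k) ≡ 𝟙 (x k ∧ U k) ℕ.+ 𝟙 (U k)
      at-k rewrite present | absent = refl

    module Sufficiency
      (cond-i  : ∀ i j k → i ≢ j → i ≢ k → j ≢ k → min∞ (H i k) (H j k) ≤∞ H i j)
      (cond-ii : ∀ i j → i ≢ j → fin 0# ≤∞ H i j) where
      open CMSolver ℝ∞-commutativeMonoid using (solve; _⊕_; _⊜_)

      -- With symmetry, (i) is the ultrametric inequality for the similarity H.
      H-ultra : ∀ {t} a b c → a ≢ b → b ≢ c → a ≢ c → t ≤∞ H a b → t ≤∞ H b c → t ≤∞ H a c
      H-ultra {t} a b c a≢b b≢c a≢c t≤ab t≤bc =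
        ≤∞-trans (≤-min∞ (H a b) (H c b) t≤ab (subst (t ≤∞_) (H-sym b c b≢c) t≤bc))
                 (cond-i a c b a≢c a≢b (b≢c ∘ sym))

      open Clusters H H-sym H-ultra

      term : Cube n → Fin n → Fin n → ℝ∞
      term x c a = scale (x a) (H c a)

      term-nonneg : ∀ {x c} → x c ≡ false → ∀ a → fin 0# ≤∞ term x c a
      term-nonneg {x} {c} xc a with x a in xa
      ... | false = ≤∞-refl (fin 0#)
      ... | true  = cond-ii c a λ { refl → true≢false (trans (sym xa) xc) }

      count-high : ∀ {x c t} → x c ≡ false → ¬ (t ≤∞ fin 0#) →
                   count t (term x c) ≡ size (x ∩ cluster c t)
      count-high {x} {c} {t} xc t≰0 = ℕΣ.sum-cong-≗ λ a → cong 𝟙 (pointwise a)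
        where
        pointwise : ∀ a → ⌊ t ≤∞? term x c a ⌋ ≡ x a ∧ ⌊ t ≤∞? D c a ⌋
        pointwise a with x a in xa
        ... | false = ⌊⌋-false (t ≤∞? fin 0#) t≰0
        ... | true  = cong (λ v → ⌊ t ≤∞? v ⌋) (sym (D-off λ { refl → true≢false (trans (sym xa) xc) }))

      count-low : ∀ {x c t} → x c ≡ false → t ≤∞ fin 0# → count t (term x c) ≡ n
      count-low {x} {c} {t} xc t≤0 = count-full (term x c) t (λ a → ≤∞-trans t≤0 (term-nonneg xc a))

      interaction-mono : ∀ {x y c} → x c ≡ false → y c ≡ false →
        (∀ t → size (y ∩ cluster c t) ℕ.≤ size (x ∩ cluster c t)) → δ y c ≤∞ δ x c
      interaction-mono {x} {y} {c} xc yc fewer = dominance (term y c) (term x c) (term-nonneg xc) counts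
        where
        counts : ∀ t → count t (term y c) ℕ.≤ count t (term x c)
        counts t with t ≤∞? fin 0#
        ... | yes t≤0 = ℕ.≤-reflexive (trans (count-low yc t≤0) (sym (count-low xc t≤0)))
        ... | no  t≰0 = subst₂ ℕ._≤_ (sym (count-high yc t≰0)) (sym (count-high xc t≰0)) (fewer t)

      interaction-exchange : ∀ {x y i j} → x i ≡ false → x j ≡ false → y i ≡ false → y j ≡ false →
        (∀ t → size (x ∩ cluster j t) ℕ.+ size (y ∩ cluster i t) ℕ.≤
               size (x ∩ cluster i t) ℕ.+ size (y ∩ cluster j t)) →
        δ x j +∞ δ y i ≤∞ δ x i +∞ δ y j
      interaction-exchange {x} {y} {i} {j} xi xj yi yj fewer =
        subst₂ _≤∞_ (ℝΣ.sum-++ (term x j) (term y i)) (ℝΣ.sum-++ (term x i) (term y j))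
          (dominance (term x j ++ term y i) (term x i ++ term y j)
                     (++-all {P = fin 0# ≤∞_} (term x i) (term y j) (term-nonneg {x} {i} xi) (term-nonneg {y} {j} yj)) counts)
        where
        counts : ∀ t → count t (term x j ++ term y i) ℕ.≤ count t (term x i ++ term y j)
        counts t = subst₂ ℕ._≤_ (sym (count-++ (term x j) (term y i) t)) (sym (count-++ (term x i) (term y j) t)) split
          where
          split : count t (term x j) ℕ.+ count t (term y i) ℕ.≤ count t (term x i) ℕ.+ count t (term y j)
          split with t ≤∞? fin 0#
          ... | yes t≤0 = ℕ.≤-reflexive (trans (cong₂ ℕ._+_ (count-low xj t≤0) (count-low yi t≤0))
                                               (sym (cong₂ ℕ._+_ (count-low xi t≤0) (count-low yj t≤0))))
          ... | no  t≰0 = subst₂ ℕ._≤_ (sym (cong₂ ℕ._+_ (count-high xj t≰0) (count-high yi t≰0)))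
                                       (sym (cong₂ ℕ._+_ (count-high xi t≰0) (count-high yj t≰0))) (fewer t)

      exchange-alone : ∀ {x x₀ y y′ i} → Inserts x x₀ i → Inserts y′ y i →
        (∀ t → size (y ∩ cluster i t) ℕ.≤ size (x₀ ∩ cluster i t)) → f x₀ +∞ f y′ ≤∞ f x +∞ f y
      exchange-alone {x} {x₀} {y} {y′} {i} x-ins y′-ins fewer = begin
        f x₀ +∞ f y′                                   ≡⟨ cong (f x₀ +∞_) (f-insert y′-ins) ⟩
        f x₀ +∞ (f y +∞ (fin (h i) +∞ δ y i))          ≲⟨ +∞-monoʳ-≤ (f x₀) (+∞-monoʳ-≤ (f y) (+∞-monoʳ-≤ (fin (h i))
                                                             (interaction-mono (Inserts.absent x-ins) (Inserts.absent y′-ins) fewer))) ⟩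
        f x₀ +∞ (f y +∞ (fin (h i) +∞ δ x₀ i))         ≡⟨ solve 4 (λ a b c d → a ⊕ (b ⊕ (c ⊕ d)) ⊜ (a ⊕ (c ⊕ d)) ⊕ b) refl
                                                               (f x₀) (f y) (fin (h i)) (δ x₀ i) ⟩
        (f x₀ +∞ (fin (h i) +∞ δ x₀ i)) +∞ f y         ≡⟨ cong (_+∞ f y) (sym (f-insert x-ins)) ⟩
        f x +∞ f y                                     ∎
        where open ≤∞-Reasoning

      exchange-pair : ∀ {x x₀ x′ y y₀ y′ i j} → Inserts x x₀ i → Inserts x′ x₀ j →
        Inserts y y₀ j → Inserts y′ y₀ i →
        (∀ t → size (x₀ ∩ cluster j t) ℕ.+ size (y₀ ∩ cluster i t) ℕ.≤
               size (x₀ ∩ cluster i t) ℕ.+ size (y₀ ∩ cluster j t)) →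
        f x′ +∞ f y′ ≤∞ f x +∞ f y
      exchange-pair {x} {x₀} {x′} {y} {y₀} {y′} {i} {j} x-ins x′-ins y-ins y′-ins fewer = begin
        f x′ +∞ f y′                                                 ≡⟨ cong₂ _+∞_ (f-insert x′-ins) (f-insert y′-ins) ⟩
        (f x₀ +∞ (fin (h j) +∞ δ x₀ j)) +∞ (f y₀ +∞ (fin (h i) +∞ δ y₀ i))
                                                                     ≡⟨ solve 6 (λ a b p q u v → (a ⊕ (q ⊕ u)) ⊕ (b ⊕ (p ⊕ v)) ⊜ ((a ⊕ b) ⊕ (p ⊕ q)) ⊕ (u ⊕ v)) refl
                                                                          (f x₀) (f y₀) (fin (h i)) (fin (h j)) (δ x₀ j) (δ y₀ i) ⟩
        common +∞ (δ x₀ j +∞ δ y₀ i)                                 ≲⟨ +∞-monoʳ-≤ common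
                                                                          (interaction-exchange (Inserts.absent x-ins) (Inserts.absent x′-ins)
                                                                                                (Inserts.absent y′-ins) (Inserts.absent y-ins) fewer) ⟩
        common +∞ (δ x₀ i +∞ δ y₀ j)                                 ≡⟨ solve 6 (λ a b p q u v → ((a ⊕ b) ⊕ (p ⊕ q)) ⊕ (u ⊕ v) ⊜ (a ⊕ (p ⊕ u)) ⊕ (b ⊕ (q ⊕ v))) refl
                                                                          (f x₀) (f y₀) (fin (h i)) (fin (h j)) (δ x₀ i) (δ y₀ j) ⟩
        (f x₀ +∞ (fin (h i) +∞ δ x₀ i)) +∞ (f y₀ +∞ (fin (h j) +∞ δ y₀ j))
                                                                     ≡⟨ cong₂ _+∞_ (sym (f-insert x-ins)) (sym (f-insert y-ins)) ⟩
        f x +∞ f y                                                   ∎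
        where
        open ≤∞-Reasoning
        common = (f x₀ +∞ f y₀) +∞ (fin (h i) +∞ fin (h j))

      -- The weights are +1 on
      -- y ∖ x₀ and -1 on x₀ ∖ y, where x₀ = x - χ_i; the exchange lemma for
      -- the clusters of i decides whether i is exchanged alone or with j.
      module Exchanging (x y : Cube n) (i : Fin n) (xi : x i ≡ true) (yi : y i ≡ false) where
        x₀ : Cube n
        x₀ = moveOut x i nothing

        w : Fin n → ℤ
        w a = + 𝟙 (y a) ℤ.- + 𝟙 (x₀ a)

        open Exchange w (λ a → 𝟙-difference≤1 (y a) (x₀ a)) i using (S; Outweighs; exchange)

        S-difference : ∀ c t → S c t ≡ + size (y ∩ cluster c t) ℤ.- + size (x₀ ∩ cluster c t)
        S-difference c t = weight-difference y x₀ (cluster c t)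

        Valid : Maybe (Fin n) → Set
        Valid j = InSuppPlus∪0 y x j × (f (moveOut x i j) +∞ f (moveIn y i j) ≤∞ f x +∞ f y)

        alone : (∀ t → S i t ℤ.≤ 0ℤ) → Valid nothing
        alone light = tt , exchange-alone (remove-point xi) (add-point yi) fewer
          where
          fewer : ∀ t → size (y ∩ cluster i t) ℕ.≤ size (x₀ ∩ cluster i t)
          fewer t = difference≤0 _ _ (subst (ℤ._≤ 0ℤ) (S-difference i t) (light t))

        partner : ∀ j → w j ≡ 1ℤ → Outweighs j → Valid (just j)
        partner j wj outweighs = (yj , xj) ,
          exchange-pair (remove-point xi) (swap-out j≢i xj) (remove-point yj) (swap-in j≢i yi) fewer
          where
          yj = proj₁ (𝟙-difference≡1 (y j) (x₀ j) wj)
          j≢i : j ≢ i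
          j≢i refl = true≢false (trans (sym yj) yi)
          xj = trans (sym (moveOut-nothing x i j≢i)) (proj₂ (𝟙-difference≡1 (y j) (x₀ j) wj))
          y₀ = moveOut y j nothing
          fewer : ∀ t → size (x₀ ∩ cluster j t) ℕ.+ size (y₀ ∩ cluster i t) ℕ.≤
                        size (x₀ ∩ cluster i t) ℕ.+ size (y₀ ∩ cluster j t)
          fewer t = exchange-arithmetic (size (y₀ ∩ cluster i t)) (size (x₀ ∩ cluster j t)) (size (x₀ ∩ cluster i t))
                                        (size (y₀ ∩ cluster j t)) (𝟙 (cluster i t j)) (subst₂ ℤ._≤_ lhs rhs (outweighs t))
            where
            y-ins = remove-point yj
            lhs : S i t ℤ.+ 1ℤ ≡ (+ (size (y₀ ∩ cluster i t) ℕ.+ 𝟙 (cluster i t j)) ℤ.- + size (x₀ ∩ cluster i t)) ℤ.+ 1ℤ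
            lhs = cong (ℤ._+ 1ℤ) (trans (S-difference i t)
                                        (cong (λ z → + z ℤ.- + size (x₀ ∩ cluster i t)) (size-insert y-ins (cluster i t))))
            rhs : S j t ℤ.+ + 𝟙 (cluster i t j) ≡
                  (+ (size (y₀ ∩ cluster j t) ℕ.+ 1) ℤ.- + size (x₀ ∩ cluster j t)) ℤ.+ + 𝟙 (cluster i t j)
            rhs = cong (ℤ._+ + 𝟙 (cluster i t j))
                    (trans (S-difference j t)
                      (cong (λ z → + z ℤ.- + size (x₀ ∩ cluster j t))
                        (trans (size-insert y-ins (cluster j t))
                               (cong (λ b → size (y₀ ∩ cluster j t) ℕ.+ 𝟙 b) (cluster-centre j t)))))

        valid : ∃ Valid
        valid with exchange
        ... | inj₁ light                = nothing , alone light
        ... | inj₂ (j , wj , outweighs) = just j , partner j wj outweighs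

      sufficiency : MNatConvex f
      sufficiency x y i xi yi = Exchanging.valid x y i xi yi

lemma1 : (R : Reals) → (n : ℕ) → 2 ℕ.≤ n →
    (h : Fin n → Reals.Carrier R) (H : Fin n → Fin n → Ext.ℝ∞ R) →
    (∀ i j → i ≢ j → H i j ≡ H j i) →
    Ext.MNatConvex R (Ext.quadFun R h H)
      ⇔ ((∀ i j k → i ≢ j → i ≢ k → j ≢ k →
            Ext._≤∞_ R (Ext.min∞ R (H i k) (H j k)) (H i j))
         × (∀ i j → i ≢ j → Ext._≤∞_ R (Ext.fin {R} (Reals.0# R)) (H i j)))
lemma1 R n _ h H H-sym = mk⇔
  (λ M → Necessity.ultrametric M , Necessity.nonneg M)
  (λ (cond-i , cond-ii) → Sufficiency.sufficiency cond-i cond-ii)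
  where open Theory.Quadratic R h H H-sym
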